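{- Let $n\ge 13$, let $S$ be an identifying code in $G=\mathrm{C}_n(1,3)$, and let $\Gamma$ be the subgraph of $G$ induced by $S$. If $u\in S$ is a heavy vertex (i.e. $\gamma(u)>11/4$) with $\deg_\Gamma(u)=2$, then the connected component $\Gamma_u$ of $\Gamma$ containing $u$ is isomorphic to the path with 3 vertices (path of length 2).
   Context: $\mathrm{C}_n(1,3)$ has vertex set $\mathbb{Z}_n$, with $x,y$ adjacent iff $x-y\equiv\pm1$ or $\pm3\pmod n$. For $u\in\mathbb{Z}_n$, $N[u]$ is its closed neighbourhood and $S_u=N[u]\cap S$. $S$ is an identifying code if the sets $S_u$, $u\in\mathbb{Z}_n$, are all nonempty and pairwise distinct. The share of $u\in S$ is $\gamma(u)=\sum_{x\in N[u]}1/|S_x|$. -}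

module Defs where

open import Data.Nat as ℕ using (ℕ; zero; suc)
open import Data.Nat.Divisibility using (_∣?_)
open import Data.Integer as ℤ using (ℤ; +_; -_)
open import Data.Integer.Divisibility using (_∣_)
open import Data.Fin using (Fin; toℕ)
open import Data.Fin.Properties using (_≟_)
open import Data.Fin.Subset using (Subset; _∈_)
open import Data.Fin.Subset.Properties using (_∈?_)
open import Data.List using (List; []; _∷_; filter; length; foldr; map; allFin)
open import Data.List.Relation.Unary.Any using (Any; any?)
open import Data.Product using (_×_; Σ; ∃; _,_)
open import Data.Sum using (_⊎_)
open import Relation.Nullary using (Dec; ¬_)
open import Relation.Nullary.Decidable using (_×-dec_; _⊎-dec_)
open import Relation.Binary.PropositionalEquality using (_≡_)
open import Relation.Binary.Construct.Closure.ReflexiveTransitive using (Star)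
open import Data.Rational as ℚ using (ℚ)
open import Function.Bundles using (_⇔_)

-- Vertex set ℤ_n is represented by Fin n (residues 0,…,n-1).

connSet : List ℤ
connSet = + 1 ∷ - (+ 1) ∷ + 3 ∷ - (+ 3) ∷ []

Adj : (n : ℕ) → Fin n → Fin n → Set
Adj n x y = Any (λ d → (+ n) ∣ ((+ toℕ x ℤ.- + toℕ y) ℤ.- d)) connSet

adj? : (n : ℕ) (x y : Fin n) → Dec (Adj n x y)
adj? n x y = any? (λ d → ℤ.∣ + n ∣ ∣? ℤ.∣ (+ toℕ x ℤ.- + toℕ y) ℤ.- d ∣) connSet

InN : (n : ℕ) → Fin n → Fin n → Set
InN n u x = (x ≡ u) ⊎ Adj n u x

inN? : (n : ℕ) (u x : Fin n) → Dec (InN n u x)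
inN? n u x = (x ≟ u) ⊎-dec adj? n u x

cardSx : (n : ℕ) → Subset n → Fin n → ℕ
cardSx n S x = length (filter (λ y → inN? n x y ×-dec (y ∈? S)) (allFin n))

-- 1 / k as a rational (k = 0 never occurs for identifying codes; set to 0)
inv : ℕ → ℚ
inv zero    = ℚ.0ℚ
inv (suc k) = + 1 ℚ./ suc k

share : (n : ℕ) → Subset n → Fin n → ℚ
share n S u = foldr ℚ._+_ ℚ.0ℚ (map (λ x → inv (cardSx n S x)) (filter (inN? n u) (allFin n)))

IsIdentifyingCode : (n : ℕ) → Subset n → Set
IsIdentifyingCode n S =
  (∀ x → ∃ λ z → z ∈ S × InN n x z) ×
  (∀ x y → (∀ z → z ∈ S → (InN n x z ⇔ InN n y z)) → x ≡ y)

ΓAdj : (n : ℕ) → Subset n → Fin n → Fin n → Set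
ΓAdj n S x y = x ∈ S × y ∈ S × Adj n x y

degΓ : (n : ℕ) → Subset n → Fin n → ℕ
degΓ n S u = length (filter (λ y → (y ∈? S) ×-dec adj? n u y) (allFin n))

InComponent : (n : ℕ) → Subset n → Fin n → Fin n → Set
InComponent n S u v = Star (ΓAdj n S) u v

P3Adj : Fin 3 → Fin 3 → Set
P3Adj i j = (suc (toℕ i) ≡ toℕ j) ⊎ (suc (toℕ j) ≡ toℕ i)

ComponentIsoP3 : (n : ℕ) → Subset n → Fin n → Set
ComponentIsoP3 n S u = Σ (Fin 3 → Fin n) λ f →
  (∀ i j → f i ≡ f j → i ≡ j) ×
  (∀ v → InComponent n S u v ⇔ (∃ λ i → f i ≡ v)) ×
  (∀ i j → ΓAdj n S (f i) (f j) ⇔ P3Adj i j)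

module Submission where

open import Defs
open import Data.Nat using (ℕ; _≤_)
open import Data.Fin using (Fin)
open import Data.Fin.Subset using (Subset; _∈_)
open import Data.Rational using (_<_; _/_)
open import Data.Integer using (+_)
open import Relation.Binary.PropositionalEquality using (_≡_)

open import Data.Bool using (Bool; true; false; T; _∧_; _∨_; not; if_then_else_)
open import Data.Bool.ListAction using (all; any)
open import Data.Bool.Properties using (T-∧; T-∨)
open import Data.Nat as ℕ using (zero; suc; NonZero; z≤n; _≡ᵇ_)
import Data.Nat.Properties as ℕ
import Data.Nat.Divisibility as ℕ
open import Data.Nat.DivMod using (m<n⇒m%n≡m)
open import Data.Nat.ListAction using (sum)
open import Data.Integer as ℤ using (ℤ; 0ℤ; -_; _-_; ∣_∣)
import Data.Integer.Properties as ℤ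
open import Data.Integer.DivMod using (_/ℕ_; _%ℕ_; n%ℕd<d; a≡a%ℕn+[a/ℕn]*n)
import Data.Integer.Divisibility as Unsigned
open import Data.Integer.Divisibility.Signed
  using (divides; ∣ᵤ⇒∣; ∣⇒∣ᵤ; ∣m∣n⇒∣m+n; ∣m∣n⇒∣m-n)
  renaming (_∣_ to _∣ℤ_)
open import Data.Integer.Tactic.RingSolver using (solve-∀)
open import Data.Rational as ℚ using (ℚ)
import Data.Rational.Properties as ℚ
open import Data.Fin as Fin using (toℕ; fromℕ<)
open import Data.Fin.Patterns using (0F; 1F; 2F)
open import Data.Fin.Properties using (toℕ-fromℕ<; toℕ-injective; toℕ<n)
open import Data.Fin.Subset.Properties using (_∈?_)
open import Data.List using (List; []; _∷_; map; foldr; length; filter; allFin)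
open import Data.List.Properties using (map-cong)
open import Data.List.Relation.Unary.Any as Any using (Any; here; there)
import Data.List.Relation.Unary.Any.Properties as Any
open import Data.List.Relation.Unary.All as All using (All)
open import Data.List.Relation.Unary.All.Properties using (all⁺)
open import Data.List.Relation.Unary.AllPairs as AllPairs using (AllPairs)
import Data.List.Relation.Unary.AllPairs.Properties as AllPairs
open import Data.List.Relation.Unary.Unique.Propositional using (Unique)
import Data.List.Relation.Unary.Unique.Propositional.Properties as Unique
open import Data.List.Membership.Propositional using () renaming (_∈_ to _∈ₗ_; _∉_ to _∉ₗ_)
open import Data.List.Membership.Propositional.Properties using (∈-map⁺; ∈-map⁻; ∈-filter⁺; ∈-filter⁻; ∈-allFin)
open import Data.List.Membership.Propositional.Properties.WithK using (unique∧set⇒bag)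
open import Data.List.Membership.DecPropositional ℤ._≟_ using () renaming (_∈?_ to _∈ℤ?_)
open import Data.List.Relation.Binary.BagAndSetEquality using (∼bag⇒↭)
open import Data.List.Relation.Binary.Permutation.Propositional using (_↭_; ↭⇒↭ₛ)
open import Data.List.Relation.Binary.Permutation.Propositional.Properties using (↭-length; map⁺)
import Data.List.Relation.Binary.Permutation.Setoid.Properties as PermutationSetoid
open import Data.Vec using (Vec; []; _∷_; lookup; tabulate)
open import Data.Product using (_×_; _,_; proj₁; proj₂; ∃; ∃₂)
open import Data.Sum using (_⊎_; inj₁; inj₂; [_,_])
open import Data.Empty using (⊥-elim)
open import Function using (_∘_; const; _⇔_; mk⇔; Equivalence)
open import Function.Properties.Equivalence using (⇔-setoid)
open import Function.Construct.Symmetry using (⇔-sym)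
open import Function.Construct.Composition using (_⇔-∘_)
open import Level using (0ℓ)
open import Relation.Binary.PropositionalEquality
  using (_≢_; refl; sym; trans; cong; subst; setoid; module ≡-Reasoning)
open import Relation.Binary.Construct.Closure.ReflexiveTransitive using (ε; _◅_)
import Relation.Binary.Reasoning.Setoid as ⇔-Reasoning
open import Relation.Nullary using (¬_; Dec; does; yes; no; contradiction)
open import Relation.Nullary.Decidable using (from-yes; ¬?; _×-dec_)
open import Relation.Unary using (Pred; Decidable)

-- Write u ⊕ i for the vertex u + i. Since n ≥ 13, the vertices u ⊕ i with |i| ≤ 6 are pairwise
-- distinct and adjacent exactly when their offsets differ by ±1 or ±3, so deg_Γ(u), γ(u), the
-- S-traces of the neighbours of u and the component Γ_u are all determined by the membership
-- pattern of S on u - 6, …, u + 6. An exhaustive check of the 2^13 patterns shows that if u ∈ S has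
-- degree 2 and share > 11/4, then either two distinct neighbours u ⊕ a, u ⊕ b have the same S-trace,
-- which an identifying code forbids, or the two Γ-neighbours u ⊕ a, u ⊕ b of u have no other
-- Γ-neighbours, so that Γ_u is the path u ⊕ a — u — u ⊕ b.

⇔-both : ∀ {A B : Set} → A → B → A ⇔ B
⇔-both a b = mk⇔ (const b) (const a)

⇔-neither : ∀ {A B : Set} → ¬ A → ¬ B → A ⇔ B
⇔-neither ¬a ¬b = mk⇔ (⊥-elim ∘ ¬a) (⊥-elim ∘ ¬b)

T-⇒ : ∀ {a b} → T (not a ∨ b) → T a → T b
T-⇒ {true} t _ = t

T-does : ∀ {A : Set} (a? : Dec A) → T (does a?) ⇔ A
T-does (yes a) = ⇔-both _ a
T-does (no ¬a) = ⇔-neither (λ ()) ¬a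

i-[i-j]≡j : ∀ i j → i - (i - j) ≡ j
i-[i-j]≡j = solve-∀

Any-⇔ : ∀ {A : Set} {P Q : A → Set} {xs} → (∀ x → P x ⇔ Q x) → Any P xs ⇔ Any Q xs
Any-⇔ P⇔Q = mk⇔ (Any.map (Equivalence.to (P⇔Q _))) (Any.map (Equivalence.from (P⇔Q _)))

∈-map⇔ : ∀ {A B : Set} {f : A → B} {y xs} → y ∈ₗ map f xs ⇔ Any (λ x → y ≡ f x) xs
∈-map⇔ {xs = xs} = mk⇔ (Any.map⁻ {xs = xs}) Any.map⁺

length-filter-map : ∀ {A B : Set} {P : Pred B 0ℓ} (P? : Decidable P) (f : A → B) xs →
  length (filter P? (map f xs)) ≡ sum (map (λ x → if does (P? (f x)) then 1 else 0) xs)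
length-filter-map P? f []       = refl
length-filter-map P? f (x ∷ xs) with does (P? (f x))
... | true  = cong suc (length-filter-map P? f xs)
... | false = length-filter-map P? f xs

filter-allFin-↭ : ∀ {n} {P : Pred (Fin n) 0ℓ} (P? : Decidable P) {ys} →
  Unique ys → (∀ y → P y ⇔ y ∈ₗ ys) → filter P? (allFin n) ↭ ys
filter-allFin-↭ {n} P? unique P⇔ = ∼bag⇒↭ (unique∧set⇒bag (Unique.filter⁺ P? (Unique.allFin⁺ n)) unique (mk⇔
  (λ y∈ → Equivalence.to (P⇔ _) (proj₂ (∈-filter⁻ P? {xs = allFin n} y∈)))
  (λ y∈ → ∈-filter⁺ P? (∈-allFin _) (Equivalence.from (P⇔ _) y∈))))

∣i-j∣≤r+s : ∀ x y {r s} → ∣ x ∣ ℕ.≤ r → ∣ y ∣ ℕ.≤ s → ∣ x - y ∣ ℕ.≤ r ℕ.+ s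
∣i-j∣≤r+s x y x≤r y≤s = ℕ.≤-trans (ℤ.∣i-j∣≤∣i∣+∣j∣ x y) (ℕ.+-mono-≤ x≤r y≤s)

∣-cong : ∀ {k a b} → k ∣ℤ a - b → k ∣ℤ a ⇔ k ∣ℤ b
∣-cong {k} {a} {b} k∣a-b = mk⇔
  (λ k∣a → subst (k ∣ℤ_) (i-[i-j]≡j a b) (∣m∣n⇒∣m-n k∣a k∣a-b))
  (λ k∣b → subst (k ∣ℤ_) (sub-add a b) (∣m∣n⇒∣m+n k∣a-b k∣b))
  where
  sub-add : ∀ a b → (a - b) ℤ.+ b ≡ a
  sub-add = solve-∀

closedNbhd : List ℤ
closedNbhd = 0ℤ ∷ connSet

nbhd : ℤ → List ℤ
nbhd k = map (λ d → k - d) closedNbhd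

connSet-bounded : All (λ d → ∣ d ∣ ℕ.≤ 3) connSet
connSet-bounded = from-yes (All.all? (λ d → ∣ d ∣ ℕ.≤? 3) connSet)

connSet-neg : ∀ {d} → d ∈ₗ connSet → - d ∈ₗ connSet
connSet-neg = All.lookup (from-yes (All.all? (λ d → - d ∈ℤ? connSet) connSet))

connSet-difference : ∀ {d e} → d ∈ₗ connSet → e ∈ₗ connSet → d - e ∉ₗ connSet
connSet-difference d∈ = All.lookup (All.lookup differences d∈)
  where
  differences : All (λ d → All (λ e → d - e ∉ₗ connSet) connSet) connSet
  differences = from-yes (All.all? (λ d → All.all? (λ e → ¬? (d - e ∈ℤ? connSet)) connSet) connSet)

0∉connSet : 0ℤ ∉ₗ connSet
0∉connSet = from-yes (¬? (0ℤ ∈ℤ? connSet))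

closedNbhd-separated : AllPairs (λ d e → d ≢ e × ∣ d - e ∣ ℕ.≤ 6) closedNbhd
closedNbhd-separated = from-yes (AllPairs.allPairs? (λ d e → ¬? (d ℤ.≟ e) ×-dec (∣ d - e ∣ ℕ.≤? 6)) closedNbhd)

connSetPairs : List (ℤ × ℤ)
connSetPairs = (+ 1 , - + 1) ∷ (+ 1 , + 3) ∷ (+ 1 , - + 3) ∷ (- + 1 , + 3) ∷ (- + 1 , - + 3) ∷ (+ 3 , - + 3) ∷ []

connSetPairs-distinct : All (λ (a , b) → a ∈ₗ connSet × b ∈ₗ connSet × a ≢ b) connSetPairs
connSetPairs-distinct = from-yes (All.all? (λ (a , b) → (a ∈ℤ? connSet) ×-dec (b ∈ℤ? connSet) ×-dec ¬? (a ℤ.≟ b)) connSetPairs)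

connSetPairs-lookup : ∀ {f : ℤ × ℤ → Bool} → Any (T ∘ f) connSetPairs →
               ∃₂ λ a b → (a ∈ₗ connSet × b ∈ₗ connSet × a ≢ b) × T (f (a , b))
connSetPairs-lookup found = _ , _ , All.lookupAny connSetPairs-distinct found

module PathOffsets {a b : ℤ} (a∈ : a ∈ₗ connSet) (b∈ : b ∈ₗ connSet) (a≢b : a ≢ b) where

  offset : Fin 3 → ℤ
  offset 0F = a
  offset 1F = 0ℤ
  offset 2F = b

  offset-bounded : ∀ i → ∣ offset i ∣ ℕ.≤ 3
  offset-bounded 0F = All.lookup connSet-bounded a∈
  offset-bounded 1F = z≤n
  offset-bounded 2F = All.lookup connSet-bounded b∈

  offset-injective : ∀ i j → offset i ≡ offset j → i ≡ j
  offset-injective 0F 0F _   = refl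
  offset-injective 0F 1F a≡0 = ⊥-elim (0∉connSet (subst (_∈ₗ connSet) a≡0 a∈))
  offset-injective 0F 2F a≡b = ⊥-elim (a≢b a≡b)
  offset-injective 1F 0F 0≡a = ⊥-elim (0∉connSet (subst (_∈ₗ connSet) (sym 0≡a) a∈))
  offset-injective 1F 1F _   = refl
  offset-injective 1F 2F 0≡b = ⊥-elim (0∉connSet (subst (_∈ₗ connSet) (sym 0≡b) b∈))
  offset-injective 2F 0F b≡a = ⊥-elim (a≢b (sym b≡a))
  offset-injective 2F 1F b≡0 = ⊥-elim (0∉connSet (subst (_∈ₗ connSet) b≡0 b∈))
  offset-injective 2F 2F _   = refl

  private
    minus-0 : ∀ {d} → d ∈ₗ connSet → d - 0ℤ ∈ₗ connSet
    minus-0 {d} = subst (_∈ₗ connSet) (sym (ℤ.+-identityʳ d))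

    0-minus : ∀ {d} → d ∈ₗ connSet → 0ℤ - d ∈ₗ connSet
    0-minus {d} = subst (_∈ₗ connSet) (sym (ℤ.+-identityˡ (- d))) ∘ connSet-neg

  offset-adjacent : ∀ i j → offset i - offset j ∈ₗ connSet ⇔ P3Adj i j
  offset-adjacent 0F 0F = ⇔-neither (connSet-difference a∈ a∈) λ { (inj₁ ()) ; (inj₂ ()) }
  offset-adjacent 0F 1F = ⇔-both (minus-0 a∈) (inj₁ refl)
  offset-adjacent 0F 2F = ⇔-neither (connSet-difference a∈ b∈) λ { (inj₁ ()) ; (inj₂ ()) }
  offset-adjacent 1F 0F = ⇔-both (0-minus a∈) (inj₂ refl)
  offset-adjacent 1F 1F = ⇔-neither 0∉connSet λ { (inj₁ ()) ; (inj₂ ()) }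
  offset-adjacent 1F 2F = ⇔-both (0-minus b∈) (inj₁ refl)
  offset-adjacent 2F 0F = ⇔-neither (connSet-difference b∈ a∈) λ { (inj₁ ()) ; (inj₂ ()) }
  offset-adjacent 2F 1F = ⇔-both (minus-0 b∈) (inj₂ refl)
  offset-adjacent 2F 2F = ⇔-neither (connSet-difference b∈ b∈) λ { (inj₁ ()) ; (inj₂ ()) }

-- β i stands for "u ⊕ i ∈ S", so count closedNbhd k is |S_{u+k}| and shareAt k is γ(u + k).
module Profile (β : ℤ → Bool) where

  count : List ℤ → ℤ → ℕ
  count ds k = sum (map (λ d → if β (k - d) then 1 else 0) ds)

  shareAt : ℤ → ℚ
  shareAt k = foldr ℚ._+_ ℚ.0ℚ (map (λ d → inv (count closedNbhd (k - d))) closedNbhd)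

  covers : List ℤ → ℤ → List ℤ → Bool
  covers ds k C = all (λ d → not (β (k - d)) ∨ does (k - d ∈ℤ? C)) ds

  sameTrace : ℤ × ℤ → Bool
  sameTrace (k , k') = covers closedNbhd k (nbhd k') ∧ covers closedNbhd k' (nbhd k)

  closed : List ℤ → Bool
  closed C = all (λ c → covers connSet c C) C

  isPath : ℤ × ℤ → Bool
  isPath (a , b) = β a ∧ β b ∧ closed (a ∷ 0ℤ ∷ b ∷ [])

  check : Bool
  check = not (β 0ℤ ∧ (count connSet 0ℤ ≡ᵇ 2) ∧ does (+ 11 / 4 ℚ.<? shareAt 0ℤ))
        ∨ any sameTrace connSetPairs ∨ any isPath connSetPairs

  check-sound : T check → T (β 0ℤ) → count connSet 0ℤ ≡ 2 → + 11 / 4 < shareAt 0ℤ →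
                Any (T ∘ sameTrace) connSetPairs ⊎ Any (T ∘ isPath) connSetPairs
  check-sound ok β0 deg heavy
    with Equivalence.to T-∨ (T-⇒ ok (Equivalence.from T-∧ (β0 , Equivalence.from T-∧
           (ℕ.≡⇒≡ᵇ _ 2 deg , Equivalence.from (T-does (+ 11 / 4 ℚ.<? shareAt 0ℤ)) heavy))))
  ... | inj₁ twins = inj₁ (Any.any⁻ sameTrace connSetPairs twins)
  ... | inj₂ path  = inj₂ (Any.any⁻ isPath connSetPairs path)

isTautology : ∀ k → (Vec Bool k → Bool) → Bool
isTautology zero    f = f []
isTautology (suc k) f = isTautology k (f ∘ (true ∷_)) ∧ isTautology k (f ∘ (false ∷_))

isTautology-sound : ∀ k f → T (isTautology k f) → ∀ bs → T (f bs)
isTautology-sound zero    f t []           = t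
isTautology-sound (suc k) f t (true ∷ bs)  = isTautology-sound k _ (proj₁ (Equivalence.to T-∧ t)) bs
isTautology-sound (suc k) f t (false ∷ bs) =
  isTautology-sound k _ (proj₂ (Equivalence.to (T-∧ {isTautology k (f ∘ (true ∷_))}) t)) bs

window : Vec Bool 13 → ℤ → Bool
window bs i with i ℤ.+ + 6
... | ℤ.-[1+ _ ] = false
... | + m with m ℕ.<? 13
...   | yes m<13 = lookup bs (fromℕ< m<13)
...   | no _     = false

restrict : (ℤ → Bool) → Vec Bool 13
restrict β = tabulate (λ i → β (+ toℕ i - + 6))

-- check β evaluates β only at integer literals in [-6, 6], where window (restrict β) agrees with β
-- definitionally; so the exhaustive evaluation over the 2^13 windows covers every β.
check-holds : ∀ β → T (Profile.check β)
check-holds β = isTautology-sound 13 (Profile.check ∘ window) _ (restrict β)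

module Residues (n : ℕ) .{{_ : NonZero n}} where

  ⟦_⟧ : ℤ → Fin n
  ⟦ z ⟧ = fromℕ< (n%ℕd<d z n)

  ⟦⟧-toℕ : ∀ x → ⟦ + toℕ x ⟧ ≡ x
  ⟦⟧-toℕ x = toℕ-injective (trans (toℕ-fromℕ< _) (m<n⇒m%n≡m (toℕ<n x)))

  n∣⟦z⟧-z : ∀ z → + n ∣ℤ + toℕ ⟦ z ⟧ - z
  n∣⟦z⟧-z z = divides (- q) (begin
    + toℕ ⟦ z ⟧ - z        ≡⟨ cong (λ x → + x - z) (toℕ-fromℕ< _) ⟩
    r - z                  ≡⟨ cong (λ x → r - x) (a≡a%ℕn+[a/ℕn]*n z n) ⟩
    r - (r ℤ.+ q ℤ.* + n)  ≡⟨ cancel r q (+ n) ⟩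
    - q ℤ.* + n            ∎)
    where
    open ≡-Reasoning
    r = + (z %ℕ n)
    q = z /ℕ n
    cancel : ∀ r q m → r - (r ℤ.+ q ℤ.* m) ≡ - q ℤ.* m
    cancel = solve-∀

  ∣⇒≡ : ∀ {z w} → ∣ z - w ∣ ℕ.< n → + n ∣ℤ z - w → z ≡ w
  ∣⇒≡ {z} {w} close n∣ = ℤ.i-j≡0⇒i≡j z w (ℤ.∣i∣≡0⇒i≡0 (multiple-of-n (∣⇒∣ᵤ n∣) close))
    where
    multiple-of-n : ∀ {m} → n ℕ.∣ m → m ℕ.< n → m ≡ 0
    multiple-of-n {zero}  _   _   = refl
    multiple-of-n {suc m} n∣m m<n = contradiction n∣m (ℕ.>⇒∤ m<n)

  ∣r-s∣<n : ∀ {r s} → r ℕ.< n → s ℕ.< n → ∣ + r - + s ∣ ℕ.< n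
  ∣r-s∣<n {r} {s} r<n s<n = begin-strict
    ∣ + r - + s ∣  ≡⟨ cong ∣_∣ (ℤ.m-n≡m⊖n r s) ⟩
    ∣ r ℤ.⊖ s ∣    ≤⟨ ℤ.∣m⊝n∣≤m⊔n r s ⟩
    r ℕ.⊔ s        <⟨ ℕ.⊔-pres-<m r<n s<n ⟩
    n              ∎
    where open ℕ.≤-Reasoning

  ⟦⟧-≡⇔ : ∀ z w → ⟦ z ⟧ ≡ ⟦ w ⟧ ⇔ + n ∣ℤ z - w
  ⟦⟧-≡⇔ z w = mk⇔ to from
    where
    swap-sub : ∀ r z w → (r - w) - (r - z) ≡ z - w
    swap-sub = solve-∀
    regroup : ∀ r s z w → ((r - z) ℤ.+ (z - w)) - (s - w) ≡ r - s
    regroup = solve-∀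
    to : ⟦ z ⟧ ≡ ⟦ w ⟧ → + n ∣ℤ z - w
    to eq = subst (+ n ∣ℤ_) (swap-sub (+ toℕ ⟦ w ⟧) z w)
      (∣m∣n⇒∣m-n (n∣⟦z⟧-z w) (subst (λ x → + n ∣ℤ + toℕ x - z) eq (n∣⟦z⟧-z z)))
    from : + n ∣ℤ z - w → ⟦ z ⟧ ≡ ⟦ w ⟧
    from n∣z-w = toℕ-injective (ℤ.+-injective (∣⇒≡ (∣r-s∣<n (toℕ<n ⟦ z ⟧) (toℕ<n ⟦ w ⟧))
      (subst (+ n ∣ℤ_) (regroup (+ toℕ ⟦ z ⟧) (+ toℕ ⟦ w ⟧) z w)
        (∣m∣n⇒∣m-n (∣m∣n⇒∣m+n (n∣⟦z⟧-z z) n∣z-w) (n∣⟦z⟧-z w)))))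

  _⊕_ : Fin n → ℤ → Fin n
  u ⊕ i = ⟦ + toℕ u ℤ.+ i ⟧

  ⊕-identityʳ : ∀ u → u ⊕ 0ℤ ≡ u
  ⊕-identityʳ u = trans (cong ⟦_⟧ (ℤ.+-identityʳ (+ toℕ u))) (⟦⟧-toℕ u)

  ⊕-≡⇒∣ : ∀ u i j → u ⊕ i ≡ u ⊕ j → + n ∣ℤ i - j
  ⊕-≡⇒∣ u i j eq =
    subst (+ n ∣ℤ_) (cancel (+ toℕ u) i j) (Equivalence.to (⟦⟧-≡⇔ (+ toℕ u ℤ.+ i) (+ toℕ u ℤ.+ j)) eq)
    where
    cancel : ∀ t i j → (t ℤ.+ i) - (t ℤ.+ j) ≡ i - j
    cancel = solve-∀

  ⊕-injective : ∀ u i j → ∣ i - j ∣ ℕ.< n → u ⊕ i ≡ u ⊕ j → i ≡ j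
  ⊕-injective u i j close = ∣⇒≡ close ∘ ⊕-≡⇒∣ u i j

  shifts : Fin n → ℤ → List ℤ → List (Fin n)
  shifts u k = map (λ d → u ⊕ (k - d))

  adj⇔∈shifts : ∀ u k y → Adj n (u ⊕ k) y ⇔ y ∈ₗ shifts u k connSet
  adj⇔∈shifts u k y = ⇔-sym ∈-map⇔ ⇔-∘ Any-⇔ step
    where
    open ⇔-Reasoning (⇔-setoid 0ℓ)
    z = + toℕ u ℤ.+ k
    Z = + toℕ (u ⊕ k)
    Y = + toℕ y
    shift : ∀ Z Y z d → ((Z - Y) - d) - ((z - d) - Y) ≡ Z - z
    shift = solve-∀
    reassoc : ∀ t k d → (t ℤ.+ k) - d ≡ t ℤ.+ (k - d)
    reassoc = solve-∀
    step : ∀ d → + n Unsigned.∣ (Z - Y) - d ⇔ y ≡ u ⊕ (k - d)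
    step d = begin
      + n Unsigned.∣ (Z - Y) - d  ≈⟨ mk⇔ ∣ᵤ⇒∣ ∣⇒∣ᵤ ⟩
      + n ∣ℤ (Z - Y) - d          ≈⟨ ∣-cong (subst (+ n ∣ℤ_) (sym (shift Z Y z d)) (n∣⟦z⟧-z z)) ⟩
      + n ∣ℤ (z - d) - Y          ≈⟨ ⇔-sym (⟦⟧-≡⇔ (z - d) Y) ⟩
      ⟦ z - d ⟧ ≡ ⟦ Y ⟧           ≈⟨ mk⇔ (λ e → sym (trans e (⟦⟧-toℕ y))) (λ e → trans (sym e) (sym (⟦⟧-toℕ y))) ⟩
      y ≡ ⟦ z - d ⟧               ≡⟨ cong (λ x → y ≡ ⟦ x ⟧) (reassoc (+ toℕ u) k d) ⟩
      y ≡ u ⊕ (k - d)             ∎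

  InN⇔∈shifts : ∀ u k y → InN n (u ⊕ k) y ⇔ y ∈ₗ shifts u k closedNbhd
  InN⇔∈shifts u k y = mk⇔
    (λ { (inj₁ y≡) → here (trans y≡ (cong (u ⊕_) (sym (ℤ.+-identityʳ k))))
       ; (inj₂ adj) → there (Equivalence.to (adj⇔∈shifts u k y) adj) })
    (λ { (here y≡)  → inj₁ (trans y≡ (cong (u ⊕_) (ℤ.+-identityʳ k)))
       ; (there y∈) → inj₂ (Equivalence.from (adj⇔∈shifts u k y) y∈) })

module Circulant (n : ℕ) (13≤n : 13 ℕ.≤ n) where

  instance
    n≢0 : NonZero n
    n≢0 = ℕ.>-nonZero (ℕ.<-≤-trans (ℕ.s≤s z≤n) 13≤n)

  open Residues n public

  ≤9⇒<n : ∀ {m} → m ℕ.≤ 9 → m ℕ.< n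
  ≤9⇒<n m≤9 = ℕ.≤-trans (ℕ.s≤s m≤9) (ℕ.≤-trans (ℕ.m≤m+n 10 3) 13≤n)

  ⊕-injective-window : ∀ u {i j} → ∣ i ∣ ℕ.≤ 3 → ∣ j ∣ ℕ.≤ 3 → u ⊕ i ≡ u ⊕ j → i ≡ j
  ⊕-injective-window u {i} {j} i≤3 j≤3 =
    ⊕-injective u i j (≤9⇒<n (ℕ.≤-trans (∣i-j∣≤r+s i j i≤3 j≤3) (ℕ.m≤m+n 6 3)))

  shifts-unique : ∀ u k → Unique (shifts u k closedNbhd)
  shifts-unique u k = AllPairs.map⁺ (AllPairs.map distinct closedNbhd-separated)
    where
    cancel : ∀ k d e → (k - d) - (k - e) ≡ e - d
    cancel = solve-∀
    distinct : ∀ {d e} → d ≢ e × ∣ d - e ∣ ℕ.≤ 6 → u ⊕ (k - d) ≢ u ⊕ (k - e)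
    distinct {d} {e} (d≢e , close) eq = d≢e (sym (∣⇒≡
      (≤9⇒<n (subst (ℕ._≤ 9) (ℤ.∣i-j∣≡∣j-i∣ d e) (ℕ.≤-trans close (ℕ.m≤m+n 6 3))))
      (subst (+ n ∣ℤ_) (cancel k d e) (⊕-≡⇒∣ u (k - d) (k - e) eq))))

  module Around (S : Subset n) (u : Fin n) where

    profile : ℤ → Bool
    profile i = does (u ⊕ i ∈? S)

    open Profile profile

    count-⊕ : ∀ {P : Pred (Fin n) 0ℓ} (P? : Decidable P) ds k → Unique (shifts u k ds) →
              (∀ y → P y ⇔ (y ∈ₗ shifts u k ds × y ∈ S)) → length (filter P? (allFin n)) ≡ count ds k
    count-⊕ P? ds k unique P⇔ = trans
      (↭-length (filter-allFin-↭ P? (Unique.filter⁺ (_∈? S) unique) (λ y → ∈-filter⇔ ⇔-∘ P⇔ y)))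
      (length-filter-map (_∈? S) (λ d → u ⊕ (k - d)) ds)
      where
      ∈-filter⇔ : ∀ {y} → (y ∈ₗ shifts u k ds × y ∈ S) ⇔ y ∈ₗ filter (_∈? S) (shifts u k ds)
      ∈-filter⇔ = mk⇔ (λ (y∈ , y∈S) → ∈-filter⁺ (_∈? S) y∈ y∈S) (∈-filter⁻ (_∈? S))

    cardSx-⊕ : ∀ k → cardSx n S (u ⊕ k) ≡ count closedNbhd k
    cardSx-⊕ k = count-⊕ _ closedNbhd k (shifts-unique u k) λ y → mk⇔
      (λ (y∈N , y∈S) → Equivalence.to (InN⇔∈shifts u k y) y∈N , y∈S)
      (λ (y∈ , y∈S) → Equivalence.from (InN⇔∈shifts u k y) y∈ , y∈S)

    degΓ-⊕ : ∀ k → degΓ n S (u ⊕ k) ≡ count connSet k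
    degΓ-⊕ k = count-⊕ _ connSet k (AllPairs.tail (shifts-unique u k)) λ y → mk⇔
      (λ (y∈S , adj) → Equivalence.to (adj⇔∈shifts u k y) adj , y∈S)
      (λ (y∈ , y∈S) → y∈S , Equivalence.from (adj⇔∈shifts u k y) y∈)

    share-⊕ : ∀ k → share n S (u ⊕ k) ≡ shareAt k
    share-⊕ k = begin
      share n S (u ⊕ k)
        ≡⟨ foldr-commMonoid ℚ.+-0-isCommutativeMonoid (↭⇒↭ₛ (map⁺ (inv ∘ cardSx n S) neighbourhood)) ⟩
      foldr ℚ._+_ ℚ.0ℚ (map (inv ∘ cardSx n S) (shifts u k closedNbhd))
        ≡⟨ cong (foldr ℚ._+_ ℚ.0ℚ) (map-cong (λ d → cong inv (cardSx-⊕ (k - d))) closedNbhd) ⟩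
      shareAt k ∎
      where
      open ≡-Reasoning
      open PermutationSetoid (setoid ℚ) using (foldr-commMonoid)
      neighbourhood : filter (inN? n (u ⊕ k)) (allFin n) ↭ shifts u k closedNbhd
      neighbourhood = filter-allFin-↭ _ (shifts-unique u k) (InN⇔∈shifts u k)

    covers-sound : ∀ ds k C {y} → T (covers ds k C) → y ∈ S → y ∈ₗ shifts u k ds → y ∈ₗ map (u ⊕_) C
    covers-sound ds k C cov y∈S y∈ with ∈-map⁻ (λ d → u ⊕ (k - d)) y∈
    ... | d , d∈ , refl = ∈-map⁺ (u ⊕_) (Equivalence.to (T-does (k - d ∈ℤ? C))
          (T-⇒ (All.lookup (all⁺ _ ds cov) d∈) (Equivalence.from (T-does (u ⊕ (k - d) ∈? S)) y∈S)))

    closed-sound : ∀ {C x y} → T (closed C) → x ∈ₗ map (u ⊕_) C → InComponent n S x y → y ∈ₗ map (u ⊕_) C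
    closed-sound cl x∈ ε = x∈
    closed-sound {C} cl x∈ ((_ , y∈S , adj) ◅ path) with ∈-map⁻ (u ⊕_) x∈
    ... | c , c∈ , refl = closed-sound {C} cl
          (covers-sound connSet c C (All.lookup (all⁺ _ C cl) c∈) y∈S (Equivalence.to (adj⇔∈shifts u c _) adj)) path

    sameTrace⇒≡ : IsIdentifyingCode n S → ∀ k k' → T (sameTrace (k , k')) → u ⊕ k ≡ u ⊕ k'
    sameTrace⇒≡ (_ , separating) k k' same = separating (u ⊕ k) (u ⊕ k') λ z z∈S →
      mk⇔ (included k k' (proj₁ traces) z∈S) (included k' k (proj₂ traces) z∈S)
      where
      traces = Equivalence.to (T-∧ {covers closedNbhd k (nbhd k')}) same
      included : ∀ k k' {z} → T (covers closedNbhd k (nbhd k')) → z ∈ S → InN n (u ⊕ k) z → InN n (u ⊕ k') z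
      included k k' {z} cov z∈S = Equivalence.from (InN⇔∈shifts u k' z)
                                ∘ covers-sound closedNbhd k (nbhd k') cov z∈S
                                ∘ Equivalence.to (InN⇔∈shifts u k z)

    adj-window : ∀ i j → ∣ i ∣ ℕ.≤ 3 → ∣ j ∣ ℕ.≤ 3 → Adj n (u ⊕ i) (u ⊕ j) ⇔ i - j ∈ₗ connSet
    adj-window i j i≤3 j≤3 = mk⇔ to from ⇔-∘ adj⇔∈shifts u i (u ⊕ j)
      where
      to : u ⊕ j ∈ₗ shifts u i connSet → i - j ∈ₗ connSet
      to j∈ with ∈-map⁻ (λ d → u ⊕ (i - d)) j∈
      ... | d , d∈ , eq = subst (_∈ₗ connSet) (sym i-j≡d) d∈
        where
        j≡i-d : j ≡ i - d
        j≡i-d = ⊕-injective u j (i - d)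
          (≤9⇒<n (∣i-j∣≤r+s j (i - d) j≤3 (∣i-j∣≤r+s i d i≤3 (All.lookup connSet-bounded d∈)))) eq
        i-j≡d : i - j ≡ d
        i-j≡d = trans (cong (λ x → i - x) j≡i-d) (i-[i-j]≡j i d)
      from : i - j ∈ₗ connSet → u ⊕ j ∈ₗ shifts u i connSet
      from ij∈ = subst (_∈ₗ shifts u i connSet) (cong (u ⊕_) (i-[i-j]≡j i j)) (∈-map⁺ (λ d → u ⊕ (i - d)) ij∈)

    isPath-sound : ∀ {a b} → T (isPath (a , b)) → u ⊕ a ∈ S × u ⊕ b ∈ S × T (closed (a ∷ 0ℤ ∷ b ∷ []))
    isPath-sound {a} {b} path with Equivalence.to T-∧ path
    ... | a∈S , rest with Equivalence.to T-∧ rest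
    ...   | b∈S , cl = Equivalence.to (T-does (u ⊕ a ∈? S)) a∈S , Equivalence.to (T-does (u ⊕ b ∈? S)) b∈S , cl

    isPath⇒P3 : ∀ {a b} → a ∈ₗ connSet → b ∈ₗ connSet → a ≢ b →
                u ⊕ 0ℤ ∈ S → u ⊕ a ∈ S → u ⊕ b ∈ S → T (closed (a ∷ 0ℤ ∷ b ∷ [])) →
                ComponentIsoP3 n S (u ⊕ 0ℤ)
    isPath⇒P3 {a} {b} a∈ b∈ a≢b centre∈S a∈S b∈S cl = f , f-injective , component , edges
      where
      open PathOffsets a∈ b∈ a≢b
      f : Fin 3 → Fin n
      f i = u ⊕ offset i
      f∈S : ∀ i → f i ∈ S
      f∈S 0F = a∈S
      f∈S 1F = centre∈S
      f∈S 2F = b∈S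
      f-injective : ∀ i j → f i ≡ f j → i ≡ j
      f-injective i j = offset-injective i j ∘ ⊕-injective-window u (offset-bounded i) (offset-bounded j)
      edges : ∀ i j → ΓAdj n S (f i) (f j) ⇔ P3Adj i j
      edges i j = begin
        ΓAdj n S (f i) (f j)            ≈⟨ mk⇔ (proj₂ ∘ proj₂) (λ adj → f∈S i , f∈S j , adj) ⟩
        Adj n (f i) (f j)               ≈⟨ adj-window (offset i) (offset j) (offset-bounded i) (offset-bounded j) ⟩
        offset i - offset j ∈ₗ connSet  ≈⟨ offset-adjacent i j ⟩
        P3Adj i j                       ∎
        where open ⇔-Reasoning (⇔-setoid 0ℓ)
      reach : ∀ i → InComponent n S (u ⊕ 0ℤ) (f i)
      reach 0F = Equivalence.from (edges 1F 0F) (inj₂ refl) ◅ ε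
      reach 1F = ε
      reach 2F = Equivalence.from (edges 1F 2F) (inj₁ refl) ◅ ε
      component : ∀ v → InComponent n S (u ⊕ 0ℤ) v ⇔ ∃ λ i → f i ≡ v
      component v = mk⇔
        (λ path → let i , _ , v≡ = ∈-map⁻ f {xs = allFin 3} (closed-sound {C = a ∷ 0ℤ ∷ b ∷ []} cl (there (here refl)) path) in i , sym v≡)
        (λ (i , fi≡v) → subst (InComponent n S (u ⊕ 0ℤ)) fi≡v (reach i))

    twins-impossible : IsIdentifyingCode n S → ¬ Any (T ∘ sameTrace) connSetPairs
    twins-impossible code twins with connSetPairs-lookup twins
    ... | a , b , (a∈ , b∈ , a≢b) , same = a≢b (⊕-injective-window u
            (All.lookup connSet-bounded a∈) (All.lookup connSet-bounded b∈) (sameTrace⇒≡ code a b same))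

    path⇒P3 : u ⊕ 0ℤ ∈ S → Any (T ∘ isPath) connSetPairs → ComponentIsoP3 n S (u ⊕ 0ℤ)
    path⇒P3 centre∈S path with connSetPairs-lookup path
    ... | a , b , (a∈ , b∈ , a≢b) , isPath with isPath-sound {a} {b} isPath
    ...   | a∈S , b∈S , cl = isPath⇒P3 a∈ b∈ a≢b centre∈S a∈S b∈S cl

    heavy-degree-two⇒P3 : IsIdentifyingCode n S → u ⊕ 0ℤ ∈ S → + 11 / 4 < share n S (u ⊕ 0ℤ) →
                          degΓ n S (u ⊕ 0ℤ) ≡ 2 → ComponentIsoP3 n S (u ⊕ 0ℤ)
    heavy-degree-two⇒P3 code centre∈S heavy deg2 =
      [ ⊥-elim ∘ twins-impossible code , path⇒P3 centre∈S ]
        (check-sound (check-holds profile) (Equivalence.from (T-does (u ⊕ 0ℤ ∈? S)) centre∈S)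
                     (trans (sym (degΓ-⊕ 0ℤ)) deg2) (subst (λ q → + 11 / 4 < q) (share-⊕ 0ℤ) heavy))

lemma5 : (n : ℕ) → 13 ≤ n → (S : Subset n) → IsIdentifyingCode n S →
    (u : Fin n) → u ∈ S → (+ 11 / 4) < share n S u → degΓ n S u ≡ 2 →
    ComponentIsoP3 n S u
lemma5 n 13≤n S code u =
  subst (λ v → v ∈ S → + 11 / 4 < share n S v → degΓ n S v ≡ 2 → ComponentIsoP3 n S v)
        (⊕-identityʳ u) (heavy-degree-two⇒P3 code)
  where
  open Circulant n 13≤n
  open Around S u
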